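{- There is no skew-symmetric amorphous association scheme with at least $4$ classes.
   Context: Let $X$ be a finite set with $|X|\ge 2$ and $R=\{R_0,\dots,R_d\}$ a set of binary relations on $X$. $(X,R)$ is an association scheme with $d$ classes if: (i) $R$ partitions $X\times X$ and $R_0=\{(x,x):x\in X\}$; (ii) for each $i$, the inverse $R_i^{T}=\{(y,x):(x,y)\in R_i\}$ equals $R_{i'}$ for some $i'$; (iii) for all $i,j,k$ there is an integer $p^k_{ij}$ such that for every $(x,y)\in R_k$, $|\{z:(x,z)\in R_i,(z,y)\in R_j\}|=p^k_{ij}$. $R_i$ is symmetric if $R_i^T=R_i$. The scheme is skew-symmetric if $R_0$ is its only symmetric relation. A partition $\Lambda_0,\Lambda_1,\dots,\Lambda_e$ of the index set $\{0,1,\dots,d\}$ is admissible if $\Lambda_0=\{0\}$, each $\Lambda_i$ is nonempty, and for each $i$ the set $\Lambda_i^T=\{\alpha':\alpha\in\Lambda_i\}$ equals some $\Lambda_j$. Given such a partition, set $R_{\Lambda_i}=\bigcup_{\alpha\in\Lambda_i}R_\alpha$; if $(X,\{R_{\Lambda_i}\}_{i=0}^e)$ is an association scheme it is called a fusion scheme. The scheme is amorphous if every admissible partition of $\{0,\dots,d\}$ gives rise to a fusion scheme. -}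

module Defs where

open import Data.Nat using (ℕ; zero; suc; _+_)
open import Data.Bool using (Bool; true; false; if_then_else_; _∧_)
open import Data.Fin using (Fin; zero; suc; _≟_)
open import Data.Product using (Σ; ∃; _×_; _,_)
open import Relation.Nullary.Decidable using (⌊_⌋)
open import Relation.Binary.PropositionalEquality using (_≡_)
open import Function.Bundles using (_⇔_)

count : {n : ℕ} → (Fin n → Bool) → ℕ
count {zero} f = 0
count {suc n} f = (if f zero then 1 else 0) + count (λ z → f (suc z))

-- A "relation assignment" on X = Fin n with relations R_0..R_d :
-- r x y = i  iff  (x , y) ∈ R_i.  This encodes that {R_i} partitions X × X
-- (each pair lies in exactly one R_i); nonemptiness of parts is required separately.
RelAssign : ℕ → ℕ → Set
RelAssign n d = Fin n → Fin n → Fin (suc d)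

IsTranspose : {n d : ℕ} → RelAssign n d → Fin (suc d) → Fin (suc d) → Set
IsTranspose r α β = ∀ x y → (r x y ≡ α ⇔ r y x ≡ β)

record IsScheme {n d : ℕ} (r : RelAssign n d) : Set where
  field
    nonempty     : ∀ i → ∃ λ x → ∃ λ y → r x y ≡ i
    diagonal     : ∀ x y → (r x y ≡ zero ⇔ x ≡ y)
    transposes   : ∀ i → ∃ λ i' → IsTranspose r i i'
    intersection : ∀ i j k → ∃ λ p → ∀ x y → r x y ≡ k →
                     count (λ z → ⌊ r x z ≟ i ⌋ ∧ ⌊ r z y ≟ j ⌋) ≡ p

SkewSymmetric : {n d : ℕ} → RelAssign n d → Set
SkewSymmetric r = ∀ i → IsTranspose r i i → i ≡ zero

-- an admissible partition Λ_0,…,Λ_e of {0,…,d}, given by Λ α = index of the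
-- part containing α
record Admissible {n d e : ℕ} (r : RelAssign n d) (Λ : Fin (suc d) → Fin (suc e)) : Set where
  field
    parts-nonempty : ∀ i → ∃ λ α → Λ α ≡ i
    part-zero      : ∀ α → (Λ α ≡ zero ⇔ α ≡ zero)
    part-transpose : ∀ i → ∃ λ j → ∀ α β → IsTranspose r α β → (Λ α ≡ i ⇔ Λ β ≡ j)

fuse : {n d e : ℕ} → RelAssign n d → (Fin (suc d) → Fin (suc e)) → RelAssign n e
fuse r Λ x y = Λ (r x y)

Amorphous : {n d : ℕ} → RelAssign n d → Set
Amorphous {n} {d} r = ∀ (e : ℕ) (Λ : Fin (suc d) → Fin (suc e)) → Admissible r Λ → IsScheme (fuse r Λ)

module Submission where

-- The argument is linear algebra over ℤ with matrices indexed
-- by the points.  Fix a class α with transpose α'.  Amorphy gives the five-class fusion R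
-- with classes {0}, {α}, {α'}, P, P' (P collects one class of each remaining transposed pair)
-- and its two three-class fusions, which are doubly regular tournaments.  With E₁, E₂ the
-- signed adjacency matrices of {α, α'} and P ∪ P', the tournaments have signed matrices
-- E₁ ± E₂, and every tournament matrix satisfies E² = J - n I with n ≡ 3 (mod 4).  Hence
-- E₁² + E₂² = J - n I and E₁ E₂ + E₂ E₁ = 0; a trace argument gives E₁ E₂ = 0, so
-- E₁³ = -n E₁.  Writing S = E₁² = -N I + b (A_α + A_α') + c (A_P + A_P') and comparing
-- row sums of 1, S and S² = -n S yields (N + c)² = n c² with N ≥ 1, impossible for n ≡ 3 mod 4.

open import Defs
open import Data.Nat as ℕ using (ℕ; zero; suc)
open import Data.Product using (∃; _×_; _,_; proj₁; proj₂)
open import Data.Sum using (_⊎_; inj₁; inj₂)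
open import Relation.Nullary using (¬_; yes; no)
open import Relation.Binary.PropositionalEquality

module Squares where
  open import Data.Nat using (_+_; _*_; _<_; _%_)
  open import Data.Nat.Properties as ℕP using ()
  open import Data.Nat.DivMod using ([m+kn]%n≡m%n)
  open import Data.Nat.Induction using (<-rec)
  open import Data.Nat.Tactic.RingSolver using (solve-∀)

  parity : ∀ a → ∃ λ h → (a ≡ h + h) ⊎ (a ≡ suc (h + h))
  parity zero = 0 , inj₁ refl
  parity (suc a) with parity a
  ... | h , inj₁ even = h , inj₂ (cong suc even)
  ... | h , inj₂ odd = suc h , inj₁ (trans (cong suc odd) (cong suc (sym (ℕP.+-suc h h))))

  residue : ∀ r r′ a b → r + a * 4 ≡ r′ + b * 4 → r % 4 ≡ r′ % 4
  residue r r′ a b eq = trans (sym ([m+kn]%n≡m%n r a 4)) (trans (cong (_% 4) eq) ([m+kn]%n≡m%n r′ b 4))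

  even-square : ∀ h → (h + h) * (h + h) ≡ (h * h) * 4
  even-square = solve-∀

  odd-square : ∀ h → suc (h + h) * suc (h + h) ≡ 1 + (h * h + h) * 4
  odd-square = solve-∀

  -- (4q + 3) c² is never a square when c ≠ 0: by descent, c and w must both be even,
  -- because squares are 0 or 1 modulo 4 while (4q + 3) times an odd square is 3 modulo 4.
  no-square : ∀ q c w → ¬ c ≡ 0 → ¬ (w * w ≡ (4 * q + 3) * (c * c))
  no-square q = <-rec (λ c → ∀ w → ¬ c ≡ 0 → ¬ (w * w ≡ (4 * q + 3) * (c * c))) descend
    where
    odd-quotient : ℕ → ℕ
    odd-quotient h = 4 * q * (h * h + h) + q + 3 * (h * h + h)
    odd-multiple : ∀ h → (4 * q + 3) * (suc (h + h) * suc (h + h)) ≡ 3 + odd-quotient h * 4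
    odd-multiple h = lemma q h
      where lemma : ∀ q h → (4 * q + 3) * (suc (h + h) * suc (h + h)) ≡ 3 + (4 * q * (h * h + h) + q + 3 * (h * h + h)) * 4
            lemma = solve-∀
    even-multiple : ∀ h → (4 * q + 3) * ((h + h) * (h + h)) ≡ ((4 * q + 3) * (h * h)) * 4
    even-multiple h = lemma q h
      where lemma : ∀ q h → (4 * q + 3) * ((h + h) * (h + h)) ≡ ((4 * q + 3) * (h * h)) * 4
            lemma = solve-∀
    descend : ∀ c → (∀ {h} → h < c → ∀ w → ¬ h ≡ 0 → ¬ (w * w ≡ (4 * q + 3) * (h * h))) →
              ∀ w → ¬ c ≡ 0 → ¬ (w * w ≡ (4 * q + 3) * (c * c))
    descend c smaller w c≢0 eq with parity c | parity w
    ... | h , inj₂ refl | g , inj₁ refl =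
      0≢3 (residue 0 3 (g * g) (odd-quotient h) (trans (sym (even-square g)) (trans eq (odd-multiple h))))
      where 0≢3 : ¬ (0 % 4 ≡ 3 % 4)
            0≢3 ()
    ... | h , inj₂ refl | g , inj₂ refl =
      1≢3 (residue 1 3 (g * g + g) (odd-quotient h) (trans (sym (odd-square g)) (trans eq (odd-multiple h))))
      where 1≢3 : ¬ (1 % 4 ≡ 3 % 4)
            1≢3 ()
    ... | h , inj₁ refl | g , inj₂ refl =
      1≢0 (residue 1 0 (g * g + g) ((4 * q + 3) * (h * h)) (trans (sym (odd-square g)) (trans eq (even-multiple h))))
      where 1≢0 : ¬ (1 % 4 ≡ 0 % 4)
            1≢0 ()
    ... | zero , inj₁ refl | g , inj₁ refl = c≢0 refl
    ... | suc h , inj₁ refl | g , inj₁ refl =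
      smaller (ℕP.m<m+n (suc h) ℕ.z<s) g (λ ()) (ℕP.*-cancelʳ-≡ (g * g) _ 4 (trans (sym (even-square g)) (trans eq (even-multiple (suc h)))))

open import Data.Integer as ℤ using (ℤ; +_; -[1+_]; _+_; _*_; -_; _-_; 0ℤ; 1ℤ; _≤_; ∣_∣)
open import Data.Integer.Properties hiding (_≟_)
open import Data.Integer.Tactic.RingSolver using (solve-∀)
open import Algebra.Properties.Semiring.Sum +-*-semiring
  using (sum; *-distribˡ-sum; *-distribʳ-sum; sum-replicate-zero)
  renaming (sum-cong-≗ to sum-cong; ∑-distrib-+ to sum-+; ∑-comm to sum-swap)
open import Data.Bool using (Bool; true; false; if_then_else_; _∧_; _∨_)
open import Data.Bool.Properties using (∨-comm)
open import Data.Fin using (Fin; zero; suc; _≟_) renaming (_<_ to _<ᶠ_)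
import Data.Fin.Properties as F
open import Relation.Binary.Definitions using (tri<; tri≈; tri>)
open import Data.Empty using (⊥; ⊥-elim)
open import Function using (_∘_)
open import Function.Bundles using (_⇔_; mk⇔; Equivalence)
open import Relation.Nullary.Decidable using (⌊_⌋)

sum-*ˡ : ∀ {n} (a : ℤ) (f : Fin n → ℤ) → sum (λ i → a * f i) ≡ a * sum f
sum-*ˡ a f = sym (*-distribˡ-sum a f)

sum-*ʳ : ∀ {n} (a : ℤ) (f : Fin n → ℤ) → sum (λ i → f i * a) ≡ sum f * a
sum-*ʳ a f = sym (*-distribʳ-sum a f)

sum-zero : ∀ {n} → sum {n} (λ _ → 0ℤ) ≡ 0ℤ
sum-zero {n} = sum-replicate-zero n

sum-neg : ∀ {n} (f : Fin n → ℤ) → sum (λ i → - f i) ≡ - sum f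
sum-neg f = trans (sum-cong (λ i → sym (-1*i≡-i (f i)))) (trans (sum-*ˡ (- 1ℤ) f) (-1*i≡-i (sum f)))

sum-const : ∀ {n} (a : ℤ) → sum {n} (λ _ → a) ≡ + n * a
sum-const {zero} a = sym (*-zeroˡ a)
sum-const {suc n} a = trans (cong (λ t → a + t) (sum-const {n} a)) (peel (+ n) a)
  where
  peel : ∀ m a → a + m * a ≡ (1ℤ + m) * a
  peel = solve-∀

sum-nonneg : ∀ {n} (f : Fin n → ℤ) → (∀ i → 0ℤ ≤ f i) → 0ℤ ≤ sum f
sum-nonneg {zero} f p = ℤ.+≤+ ℕ.z≤n
sum-nonneg {suc n} f p = +-mono-≤ (p zero) (sum-nonneg (f ∘ suc) (p ∘ suc))

term≤sum : ∀ {n} (f : Fin n → ℤ) → (∀ i → 0ℤ ≤ f i) → ∀ k → f k ≤ sum f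
term≤sum {suc n} f p zero =
  ≤-trans (≤-reflexive (sym (+-identityʳ (f zero)))) (+-monoʳ-≤ (f zero) (sum-nonneg (f ∘ suc) (p ∘ suc)))
term≤sum {suc n} f p (suc k) =
  ≤-trans (≤-reflexive (sym (+-identityˡ (f (suc k))))) (+-mono-≤ (p zero) (term≤sum (f ∘ suc) (p ∘ suc) k))

ind : Bool → ℤ
ind true = 1ℤ
ind false = 0ℤ

ind-∧ : ∀ p q → ind (p ∧ q) ≡ ind p * ind q
ind-∧ true true = refl
ind-∧ true false = refl
ind-∧ false q = refl

count-sum : ∀ {n} (f : Fin n → Bool) → + count f ≡ sum (λ z → ind (f z))
count-sum {zero} f = refl
count-sum {suc n} f = trans (pos-+ (if f zero then 1 else 0) (count (f ∘ suc))) (cong₂ _+_ (head (f zero)) (count-sum (f ∘ suc)))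
  where
  head : ∀ b → + (if b then 1 else 0) ≡ ind b
  head true = refl
  head false = refl

δ : ∀ {n} → Fin n → Fin n → ℤ
δ x y = ind ⌊ x ≟ y ⌋

δ-≢ : ∀ {n} {x y : Fin n} → ¬ x ≡ y → δ x y ≡ 0ℤ
δ-≢ {x = x} {y} x≢y with x ≟ y
... | yes x≡y = ⊥-elim (x≢y x≡y)
... | no _ = refl

δ-sym : ∀ {n} (x y : Fin n) → δ x y ≡ δ y x
δ-sym x y with x ≟ y | y ≟ x
... | yes _ | yes _ = refl
... | no _ | no _ = refl
... | yes x≡y | no y≢x = ⊥-elim (y≢x (sym x≡y))
... | no x≢y | yes y≡x = ⊥-elim (x≢y (sym y≡x))

δ-suc : ∀ {n} (x y : Fin n) → δ {suc n} (suc x) (suc y) ≡ δ x y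
δ-suc x y with x ≟ y
... | yes _ = refl
... | no _ = refl

sum-δ : ∀ {n} (a : Fin n) (h : Fin n → ℤ) → sum (λ i → δ a i * h i) ≡ h a
sum-δ {suc n} zero h =
  trans (cong₂ _+_ (*-identityˡ (h zero)) (trans (sum-cong (λ i → *-zeroˡ (h (suc i)))) (sum-zero {n}))) (+-identityʳ (h zero))
sum-δ {suc n} (suc a) h =
  trans (+-identityˡ _) (trans (sum-cong (λ i → cong (_* h (suc i)) (δ-suc a i))) (sum-δ a (h ∘ suc)))

sum-δʳ : ∀ {n} (a : Fin n) (h : Fin n → ℤ) → sum (λ i → h i * δ i a) ≡ h a
sum-δʳ a h = trans (sum-cong (λ i → trans (*-comm (h i) (δ i a)) (cong (_* h i) (δ-sym i a)))) (sum-δ a h)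

sum-δ-one : ∀ {n} (a : Fin n) → sum (δ a) ≡ 1ℤ
sum-δ-one a = trans (sum-cong (λ i → sym (*-identityʳ (δ a i)))) (sum-δ a (λ _ → 1ℤ))

cancel-pos : ∀ m t → + suc m * t ≡ 0ℤ → t ≡ 0ℤ
cancel-pos m t eq = *-cancelˡ-≡ (+ suc m) t 0ℤ (trans eq (sym (*-zeroʳ (+ suc m))))

self-neg : ∀ t → t ≡ - t → t ≡ 0ℤ
self-neg t eq = cancel-pos 1 t (trans (double t) (trans (cong (λ s → t + s) eq) (+-inverseʳ t)))
  where double : ∀ t → + 2 * t ≡ t + t
        double = solve-∀

plus-minus : ∀ u v w → u + v ≡ w → u - v ≡ w → v ≡ 0ℤ
plus-minus u v w eq₁ eq₂ = cancel-pos 1 v (trans (split u v) (trans (cong₂ _-_ eq₁ eq₂) (+-inverseʳ w)))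
  where split : ∀ u v → + 2 * v ≡ (u + v) - (u - v)
        split = solve-∀

1≰0 : ¬ (1ℤ ≤ 0ℤ)
1≰0 (ℤ.+≤+ ())

sum-antisym : ∀ {n} (f : Fin n → Fin n → ℤ) → (∀ y z → f z y ≡ - f y z) → sum (λ y → sum (f y)) ≡ 0ℤ
sum-antisym f anti = self-neg _ (begin
  sum (λ y → sum (f y))               ≡⟨ sum-swap f ⟩
  sum (λ z → sum (λ y → f y z))       ≡⟨ sum-cong (λ z → sum-cong (λ y → anti z y)) ⟩
  sum (λ z → sum (λ y → - f z y))     ≡⟨ sum-cong (λ z → sum-neg (f z)) ⟩
  sum (λ z → - sum (f z))             ≡⟨ sum-neg (λ z → sum (f z)) ⟩
  - sum (λ y → sum (f y))             ∎)
  where open ≡-Reasoning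

positive-factor : ∀ {a S : ℤ} → 1ℤ ≤ S → a * S ≡ 0ℤ → a ≡ 0ℤ
positive-factor {a} S≥1 aS≡0 with i*j≡0⇒i≡0∨j≡0 a aS≡0
... | inj₁ a≡0 = a≡0
... | inj₂ refl = ⊥-elim (1≰0 S≥1)

sum-≥1 : ∀ {n} (f : Fin n → ℤ) → (∀ i → 0ℤ ≤ f i) → ∀ k → f k ≡ 1ℤ → 1ℤ ≤ sum f
sum-≥1 f nonneg k fk≡1 = subst (_≤ sum f) fk≡1 (term≤sum f nonneg k)

Mat : ℕ → Set
Mat n = Fin n → Fin n → ℤ

_⊞_ _⊟_ _⊛_ : ∀ {n} → Mat n → Mat n → Mat n
(A ⊞ B) x y = A x y + B x y
(A ⊟ B) x y = A x y - B x y
(A ⊛ B) x y = sum (λ z → A x z * B z y)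

Skew : ∀ {n} → Mat n → Set
Skew A = ∀ x y → A y x ≡ - A x y

RowsZero : ∀ {n} → Mat n → Set
RowsZero A = ∀ x → sum (A x) ≡ 0ℤ

⊛-cong : ∀ {n} {A A' B B' : Mat n} → (∀ x y → A x y ≡ A' x y) → (∀ x y → B x y ≡ B' x y) →
  ∀ x y → (A ⊛ B) x y ≡ (A' ⊛ B') x y
⊛-cong eqA eqB x y = sum-cong (λ z → cong₂ _*_ (eqA x z) (eqB z y))

⊛-assoc : ∀ {n} (A B C : Mat n) x y → ((A ⊛ B) ⊛ C) x y ≡ (A ⊛ (B ⊛ C)) x y
⊛-assoc A B C x y = begin
  sum (λ w → sum (λ z → A x z * B z w) * C w y)     ≡⟨ sum-cong (λ w → sym (sum-*ʳ (C w y) (λ z → A x z * B z w))) ⟩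
  sum (λ w → sum (λ z → A x z * B z w * C w y))     ≡⟨ sum-swap (λ w z → A x z * B z w * C w y) ⟩
  sum (λ z → sum (λ w → A x z * B z w * C w y))     ≡⟨ sum-cong (λ z → sum-cong (λ w → *-assoc (A x z) (B z w) (C w y))) ⟩
  sum (λ z → sum (λ w → A x z * (B z w * C w y)))   ≡⟨ sum-cong (λ z → sum-*ˡ (A x z) (λ w → B z w * C w y)) ⟩
  sum (λ z → A x z * sum (λ w → B z w * C w y))     ∎
  where open ≡-Reasoning

skew-⊛-transpose : ∀ {n} {A B : Mat n} → Skew A → Skew B → ∀ x y → (A ⊛ B) y x ≡ (B ⊛ A) x y
skew-⊛-transpose {A = A} {B} skA skB x y =
  sum-cong (λ z → trans (cong₂ _*_ (skA z y) (skB x z)) (neg-neg (A z y) (B x z)))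
  where neg-neg : ∀ a b → (- a) * (- b) ≡ b * a
        neg-neg = solve-∀

rows-zero-⊛ : ∀ {n} (A : Mat n) {B : Mat n} → RowsZero B → RowsZero (A ⊛ B)
rows-zero-⊛ {n} A {B} rowsB x = begin
  sum (λ y → sum (λ z → A x z * B z y))   ≡⟨ sum-swap (λ y z → A x z * B z y) ⟩
  sum (λ z → sum (λ y → A x z * B z y))   ≡⟨ sum-cong (λ z → sum-*ˡ (A x z) (B z)) ⟩
  sum (λ z → A x z * sum (B z))           ≡⟨ sum-cong (λ z → trans (cong (A x z *_) (rowsB z)) (*-zeroʳ (A x z))) ⟩
  sum {n} (λ _ → 0ℤ)                      ≡⟨ sum-zero {n} ⟩
  0ℤ                                      ∎
  where open ≡-Reasoning

-- A skew matrix whose row sums are all equal has zero row sums (their total is its own negative).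
skew-rows-zero : ∀ {m} (A : Mat (suc m)) → Skew A → (∀ x → sum (A x) ≡ sum (A zero)) → RowsZero A
skew-rows-zero {m} A skA constant x = trans (constant x) (cancel-pos m (sum (A zero)) (begin
  + suc m * sum (A zero)            ≡⟨ sym (sum-const {suc m} (sum (A zero))) ⟩
  sum {suc m} (λ _ → sum (A zero))  ≡⟨ sum-cong (λ y → sym (constant y)) ⟩
  sum (λ y → sum (A y))             ≡⟨ sum-antisym A (λ y z → skA y z) ⟩
  0ℤ                                ∎))
  where open ≡-Reasoning

skew-cols-zero : ∀ {n} {A : Mat n} → Skew A → RowsZero A → ∀ y → sum (λ x → A x y) ≡ 0ℤ
skew-cols-zero {A = A} skA rows y = trans (sum-cong (skA y)) (trans (sum-neg (A y)) (cong -_ (rows y)))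

form-skewʳ : ∀ {n} (A : Mat n) {B : Mat n} → Skew B → ∀ x → sum (λ y → A x y * (A ⊛ B) x y) ≡ 0ℤ
form-skewʳ A {B} skB x =
  trans (sum-cong (λ y → sym (sum-*ˡ (A x y) (λ z → A x z * B z y))))
        (sum-antisym (λ y z → A x y * (A x z * B z y))
           (λ y z → trans (cong (λ t → A x z * (A x y * t)) (skB z y)) (swap (A x y) (A x z) (B z y))))
  where swap : ∀ a b c → b * (a * (- c)) ≡ - (a * (b * c))
        swap = solve-∀

form-skewˡ : ∀ {n} {A : Mat n} (B : Mat n) → Skew A → ∀ y → sum (λ x → B x y * (A ⊛ B) x y) ≡ 0ℤ
form-skewˡ {A = A} B skA y =
  trans (sum-cong (λ x → sym (sum-*ˡ (B x y) (λ z → A x z * B z y))))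
        (sum-antisym (λ x z → B x y * (A x z * B z y))
           (λ x z → trans (cong (λ t → B z y * (t * B x y)) (skA x z)) (swap (B x y) (A x z) (B z y))))
  where swap : ∀ a b c → c * ((- b) * a) ≡ - (a * (b * c))
        swap = solve-∀

⊛-square-⊞ : ∀ {n} (A B : Mat n) x y →
  ((A ⊞ B) ⊛ (A ⊞ B)) x y ≡ ((A ⊛ A) x y + (B ⊛ B) x y) + ((A ⊛ B) x y + (B ⊛ A) x y)
⊛-square-⊞ A B x y = begin
  sum (λ z → (A x z + B x z) * (A z y + B z y))
    ≡⟨ sum-cong (λ z → expand (A x z) (B x z) (A z y) (B z y)) ⟩
  sum (λ z → (A x z * A z y + B x z * B z y) + (A x z * B z y + B x z * A z y))
    ≡⟨ sum-+ (λ z → A x z * A z y + B x z * B z y) (λ z → A x z * B z y + B x z * A z y) ⟩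
  sum (λ z → A x z * A z y + B x z * B z y) + sum (λ z → A x z * B z y + B x z * A z y)
    ≡⟨ cong₂ _+_ (sum-+ (λ z → A x z * A z y) (λ z → B x z * B z y)) (sum-+ (λ z → A x z * B z y) (λ z → B x z * A z y)) ⟩
  ((A ⊛ A) x y + (B ⊛ B) x y) + ((A ⊛ B) x y + (B ⊛ A) x y) ∎
  where
  open ≡-Reasoning
  expand : ∀ a b c d → (a + b) * (c + d) ≡ (a * c + b * d) + (a * d + b * c)
  expand = solve-∀

⊛-square-⊟ : ∀ {n} (A B : Mat n) x y →
  ((A ⊟ B) ⊛ (A ⊟ B)) x y ≡ ((A ⊛ A) x y + (B ⊛ B) x y) - ((A ⊛ B) x y + (B ⊛ A) x y)
⊛-square-⊟ A B x y = begin
  sum (λ z → (A x z - B x z) * (A z y - B z y))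
    ≡⟨ sum-cong (λ z → expand (A x z) (B x z) (A z y) (B z y)) ⟩
  sum (λ z → (A x z * A z y + B x z * B z y) + - (A x z * B z y + B x z * A z y))
    ≡⟨ sum-+ (λ z → A x z * A z y + B x z * B z y) (λ z → - (A x z * B z y + B x z * A z y)) ⟩
  sum (λ z → A x z * A z y + B x z * B z y) + sum (λ z → - (A x z * B z y + B x z * A z y))
    ≡⟨ cong₂ _+_ (sum-+ (λ z → A x z * A z y) (λ z → B x z * B z y))
                 (trans (sum-neg (λ z → A x z * B z y + B x z * A z y))
                        (cong -_ (sum-+ (λ z → A x z * B z y) (λ z → B x z * A z y)))) ⟩
  ((A ⊛ A) x y + (B ⊛ B) x y) - ((A ⊛ B) x y + (B ⊛ A) x y) ∎
  where
  open ≡-Reasoning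
  expand : ∀ a b c d → (a - b) * (c - d) ≡ (a * c + b * d) + - (a * d + b * c)
  expand = solve-∀

diag-offdiag : ∀ {n} (K : Mat n) {a c : ℤ} → (∀ x → K x x ≡ a) → (∀ {x y} → ¬ x ≡ y → K x y ≡ c) →
  ∀ x y → K x y ≡ c + (a - c) * δ x y
diag-offdiag K {a} {c} on off x y with x ≟ y
... | yes refl = trans (on x) (split a c)
  where split : ∀ a c → a ≡ c + (a - c) * 1ℤ
        split = solve-∀
... | no x≢y = trans (off x≢y) (sym (trans (cong (λ t → c + t) (*-zeroʳ (a - c))) (+-identityʳ c)))

row-sum-diag-offdiag : ∀ {n} (a c : ℤ) (x : Fin n) → sum (λ y → c + (a - c) * δ x y) ≡ + n * c + (a - c)
row-sum-diag-offdiag {n} a c x =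
  trans (sum-+ (λ _ → c) (λ y → (a - c) * δ x y))
        (cong₂ _+_ (sum-const {n} c) (trans (sum-*ˡ (a - c) (δ x)) (trans (cong ((a - c) *_) (sum-δ-one x)) (*-identityʳ (a - c)))))

⊛-plus-ones : ∀ {n} (A B : Mat n) x y →
  sum (λ z → (1ℤ + A x z) * (1ℤ + B z y)) ≡ + n + sum (A x) + sum (λ z → B z y) + (A ⊛ B) x y
⊛-plus-ones {n} A B x y = begin
  sum (λ z → (1ℤ + A x z) * (1ℤ + B z y))                 ≡⟨ sum-cong (λ z → expand (A x z) (B z y)) ⟩
  sum (λ z → 1ℤ + A x z + B z y + A x z * B z y)         ≡⟨ sum-+ (λ z → 1ℤ + A x z + B z y) (λ z → A x z * B z y) ⟩
  sum (λ z → 1ℤ + A x z + B z y) + (A ⊛ B) x y           ≡⟨ cong (_+ (A ⊛ B) x y) (sum-+ (λ z → 1ℤ + A x z) (λ z → B z y)) ⟩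
  sum (λ z → 1ℤ + A x z) + sum (λ z → B z y) + (A ⊛ B) x y
    ≡⟨ cong (λ t → t + sum (λ z → B z y) + (A ⊛ B) x y) (trans (sum-+ (λ _ → 1ℤ) (A x)) (cong (_+ sum (A x)) (trans (sum-const {n} 1ℤ) (*-identityʳ (+ n))))) ⟩
  + n + sum (A x) + sum (λ z → B z y) + (A ⊛ B) x y        ∎
  where
  open ≡-Reasoning
  expand : ∀ a b → (1ℤ + a) * (1ℤ + b) ≡ 1ℤ + a + b + a * b
  expand = solve-∀

⊛-plus-identity : ∀ {n} (U V : Mat n) x y →
  sum (λ z → (U x z + δ x z) * (V z y + δ z y)) ≡ (U ⊛ V) x y + U x y + V x y + δ x y
⊛-plus-identity {n} U V x y = begin
  sum (λ z → (U x z + δ x z) * (V z y + δ z y))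
    ≡⟨ sum-cong (λ z → expand (U x z) (δ x z) (V z y) (δ z y)) ⟩
  sum (λ z → U x z * V z y + U x z * δ z y + δ x z * V z y + δ x z * δ z y)
    ≡⟨ trans (sum-+ (λ z → u z + ud z + dv z) dd)
             (cong (_+ sum dd) (trans (sum-+ (λ z → u z + ud z) dv) (cong (_+ sum dv) (sum-+ u ud)))) ⟩
  (U ⊛ V) x y + sum (λ z → U x z * δ z y) + sum (λ z → δ x z * V z y) + sum (λ z → δ x z * δ z y)
    ≡⟨ cong₂ (λ s t → (U ⊛ V) x y + s + t + sum (λ z → δ x z * δ z y)) (sum-δʳ y (U x)) (sum-δ x (λ z → V z y)) ⟩
  (U ⊛ V) x y + U x y + V x y + sum (λ z → δ x z * δ z y)
    ≡⟨ cong (λ t → (U ⊛ V) x y + U x y + V x y + t) (sum-δ x (λ z → δ z y)) ⟩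
  (U ⊛ V) x y + U x y + V x y + δ x y ∎
  where
  open ≡-Reasoning
  u ud dv dd : Fin n → ℤ
  u z = U x z * V z y
  ud z = U x z * δ z y
  dv z = δ x z * V z y
  dd z = δ x z * δ z y
  expand : ∀ u d v d' → (u + d) * (v + d') ≡ u * v + u * d' + d * v + d * d'
  expand = solve-∀

sum-by-classes : ∀ {n m} (a b : Fin n → Fin m) (g : Fin m → Fin m → ℤ) →
  sum (λ z → g (a z) (b z)) ≡ sum (λ i → sum (λ j → + count (λ z → ⌊ a z ≟ i ⌋ ∧ ⌊ b z ≟ j ⌋) * g i j))
sum-by-classes {n} {m} a b g = begin
  sum (λ z → g (a z) (b z))
    ≡⟨ sum-cong (λ z → sym (trans (sum-cong (λ i → cong (χa z i *_) (sum-δ (b z) (g i)))) (sum-δ (a z) (λ i → g i (b z))))) ⟩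
  sum (λ z → sum (λ i → χa z i * sum (λ j → χb z j * g i j)))
    ≡⟨ sum-cong (λ z → sum-cong (λ i → sym (sum-*ˡ (χa z i) (λ j → χb z j * g i j)))) ⟩
  sum (λ z → sum (λ i → sum (λ j → χa z i * (χb z j * g i j))))
    ≡⟨ sum-swap (λ z i → sum (λ j → χa z i * (χb z j * g i j))) ⟩
  sum (λ i → sum (λ z → sum (λ j → χa z i * (χb z j * g i j))))
    ≡⟨ sum-cong (λ i → sum-swap (λ z j → χa z i * (χb z j * g i j))) ⟩
  sum (λ i → sum (λ j → sum (λ z → χa z i * (χb z j * g i j))))
    ≡⟨ sum-cong (λ i → sum-cong (λ j → trans (sum-cong (λ z → indicator z i j)) (sum-*ʳ (g i j) (λ z → ind (both z i j))))) ⟩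
  sum (λ i → sum (λ j → sum (λ z → ind (both z i j)) * g i j))
    ≡⟨ sum-cong (λ i → sum-cong (λ j → cong (_* g i j) (sym (count-sum (λ z → both z i j))))) ⟩
  sum (λ i → sum (λ j → + count (λ z → both z i j) * g i j))
    ∎
  where
  open ≡-Reasoning
  χa χb : Fin n → Fin m → ℤ
  χa z i = δ (a z) i
  χb z j = δ (b z) j
  both : Fin n → Fin m → Fin m → Bool
  both z i j = ⌊ a z ≟ i ⌋ ∧ ⌊ b z ≟ j ⌋
  indicator : ∀ z i j → χa z i * (χb z j * g i j) ≡ ind (both z i j) * g i j
  indicator z i j = trans (sym (*-assoc (χa z i) (χb z j) (g i j)))
                          (cong (_* g i j) (sym (ind-∧ ⌊ a z ≟ i ⌋ ⌊ b z ≟ j ⌋)))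

-- In an association scheme, a sum Σ_z g(class(x,z), class(z,y)) depends only on the class
-- of (x, y): it is a combination of the intersection numbers p^k_ij.
two-step-invariant : ∀ {n e} {F : RelAssign n e} → IsScheme F → (g : Fin (suc e) → Fin (suc e) → ℤ) →
  ∀ {x y x' y'} → F x y ≡ F x' y' → sum (λ z → g (F x z) (F z y)) ≡ sum (λ z → g (F x' z) (F z y'))
two-step-invariant {F = F} sch g {x} {y} {x'} {y'} same =
  trans (sum-by-classes (F x) (λ z → F z y) g)
        (trans (sum-cong (λ i → sum-cong (λ j → cong (λ t → + t * g i j) (intersection-number i j))))
               (sym (sum-by-classes (F x') (λ z → F z y') g)))
  where
  intersection-number : ∀ i j → count (λ z → ⌊ F x z ≟ i ⌋ ∧ ⌊ F z y ≟ j ⌋) ≡ count (λ z → ⌊ F x' z ≟ i ⌋ ∧ ⌊ F z y' ≟ j ⌋)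
  intersection-number i j with IsScheme.intersection sch i j (F x y)
  ... | p , p-spec = trans (p-spec x y refl) (sym (p-spec x' y' (sym same)))

module SchemeFacts {n d : ℕ} {r : RelAssign n d} (sch : IsScheme r) where

  Class : Set
  Class = Fin (suc d)

  tr : Class → Class
  tr α = proj₁ (IsScheme.transposes sch α)

  flip : ∀ x y → r y x ≡ tr (r x y)
  flip x y = Equivalence.to (proj₂ (IsScheme.transposes sch (r x y)) x y) refl

  diagonal : ∀ x → r x x ≡ zero
  diagonal x = Equivalence.from (IsScheme.diagonal sch x x) refl

  off-diagonal : ∀ {x y} → r x y ≡ zero → x ≡ y
  off-diagonal {x} {y} = Equivalence.to (IsScheme.diagonal sch x y)

  tr-involutive : ∀ α → tr (tr α) ≡ α
  tr-involutive α with IsScheme.nonempty sch α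
  ... | x , y , refl = trans (cong tr (sym (flip x y))) (sym (flip y x))

  tr-injective : ∀ {α β} → tr α ≡ tr β → α ≡ β
  tr-injective {α} {β} eq = trans (sym (tr-involutive α)) (trans (cong tr eq) (tr-involutive β))

  tr-zero : tr zero ≡ zero
  tr-zero with IsScheme.nonempty sch zero
  ... | x , y , rxy≡0 with off-diagonal rxy≡0
  ... | refl = trans (cong tr (sym rxy≡0)) (trans (sym (flip x x)) rxy≡0)

  transpose-unique : ∀ {α β} → IsTranspose r α β → β ≡ tr α
  transpose-unique {α} {β} t with IsScheme.nonempty sch α
  ... | x , y , refl = trans (sym (Equivalence.to (t x y) refl)) (flip x y)

  row-sum-invariant : (s : Class → ℤ) → ∀ x x' → sum (λ z → s (r x z)) ≡ sum (λ z → s (r x' z))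
  row-sum-invariant s x x' = two-step-invariant sch (λ i _ → s i) (trans (diagonal x) (sym (diagonal x')))

  δ-diagonal : ∀ x y → δ x y ≡ ind ⌊ r x y ≟ zero ⌋
  δ-diagonal x y with x ≟ y | r x y ≟ zero
  ... | yes _ | yes _ = refl
  ... | no _ | no _ = refl
  ... | yes refl | no rxx≢0 = ⊥-elim (rxx≢0 (diagonal x))
  ... | no x≢y | yes rxy≡0 = ⊥-elim (x≢y (off-diagonal rxy≡0))

record FusionMap {d e : ℕ} (σ : Fin (suc d) → Fin (suc d)) (τ : Fin (suc e) → Fin (suc e))
                 (Λ : Fin (suc d) → Fin (suc e)) : Set where
  field
    onto      : ∀ i → ∃ λ α → Λ α ≡ i
    zero-iff  : ∀ α → Λ α ≡ zero ⇔ α ≡ zero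
    intertwin : ∀ α → Λ (σ α) ≡ τ (Λ α)

compose : ∀ {d e f} {σ : Fin (suc d) → Fin (suc d)} {τ : Fin (suc e) → Fin (suc e)} {ρ : Fin (suc f) → Fin (suc f)}
  {Λ : Fin (suc d) → Fin (suc e)} {μ : Fin (suc e) → Fin (suc f)} →
  FusionMap σ τ Λ → FusionMap τ ρ μ → FusionMap σ ρ (μ ∘ Λ)
compose {Λ = Λ} {μ} ΛF μF = record
  { onto      = λ i → let (j , μj≡i) = μ.onto i ; (α , Λα≡j) = Λ.onto j in α , trans (cong μ Λα≡j) μj≡i
  ; zero-iff  = λ α → mk⇔ (λ eq → Equivalence.to (Λ.zero-iff α) (Equivalence.to (μ.zero-iff (Λ α)) eq))
                          (λ eq → Equivalence.from (μ.zero-iff (Λ α)) (Equivalence.from (Λ.zero-iff α) eq))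
  ; intertwin = λ α → trans (cong μ (Λ.intertwin α)) (μ.intertwin (Λ α))
  }
  where
  module Λ = FusionMap ΛF
  module μ = FusionMap μF

admissible : ∀ {n d e} {r : RelAssign n d} (sch : IsScheme r) {τ : Fin (suc e) → Fin (suc e)}
  {Λ : Fin (suc d) → Fin (suc e)} → (∀ i → τ (τ i) ≡ i) → FusionMap (SchemeFacts.tr sch) τ Λ → Admissible r Λ
admissible sch {τ} {Λ} τ-involutive ΛF = record
  { parts-nonempty = onto
  ; part-zero      = zero-iff
  ; part-transpose = λ i → τ i , λ α β t →
      let Λβ≡τΛα = trans (cong Λ (transpose-unique t)) (intertwin α)
      in mk⇔ (λ Λα≡i → trans Λβ≡τΛα (cong τ Λα≡i))
             (λ Λβ≡τi → trans (sym (τ-involutive (Λ α))) (trans (cong τ (sym Λβ≡τΛα)) (trans (cong τ Λβ≡τi) (τ-involutive i))))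
  }
  where
  open SchemeFacts sch
  open FusionMap ΛF

-- Two-class skew-symmetric schemes (doubly regular tournaments).  Class 1 and class 2 are
-- transposes of each other; E = A₁ - A₂ is the signed adjacency matrix.

swap₃ : Fin 3 → Fin 3
swap₃ zero = zero
swap₃ (suc zero) = suc (suc zero)
swap₃ (suc (suc zero)) = suc zero

swap₃-involutive : ∀ i → swap₃ (swap₃ i) ≡ i
swap₃-involutive zero = refl
swap₃-involutive (suc zero) = refl
swap₃-involutive (suc (suc zero)) = refl

sgn : Fin 3 → ℤ
sgn zero = 0ℤ
sgn (suc zero) = 1ℤ
sgn (suc (suc zero)) = - 1ℤ

arc : Fin 3 → ℤ
arc zero = 0ℤ
arc (suc zero) = 1ℤ
arc (suc (suc zero)) = 0ℤ

sgn-swap : ∀ i → sgn (swap₃ i) ≡ - sgn i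
sgn-swap zero = refl
sgn-swap (suc zero) = refl
sgn-swap (suc (suc zero)) = refl

sgn-return : ∀ i → sgn i * sgn (swap₃ i) ≡ ind ⌊ i ≟ zero ⌋ - 1ℤ
sgn-return zero = refl
sgn-return (suc zero) = refl
sgn-return (suc (suc zero)) = refl

sgn-arc : ∀ i → 1ℤ + sgn i ≡ + 2 * arc i + ind ⌊ i ≟ zero ⌋
sgn-arc zero = refl
sgn-arc (suc zero) = refl
sgn-arc (suc (suc zero)) = refl

nonzero-classes : ∀ i j → ¬ i ≡ zero → ¬ j ≡ zero → (j ≡ i) ⊎ (j ≡ swap₃ i)
nonzero-classes zero j i≢0 j≢0 = ⊥-elim (i≢0 refl)
nonzero-classes i zero i≢0 j≢0 = ⊥-elim (j≢0 refl)
nonzero-classes (suc zero) (suc zero) _ _ = inj₁ refl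
nonzero-classes (suc zero) (suc (suc zero)) _ _ = inj₂ refl
nonzero-classes (suc (suc zero)) (suc zero) _ _ = inj₂ refl
nonzero-classes (suc (suc zero)) (suc (suc zero)) _ _ = inj₁ refl

module Tournament {m : ℕ} (F : RelAssign (suc (suc m)) 2) (sch : IsScheme F)
                  (F-flip : ∀ x y → F y x ≡ swap₃ (F x y)) where

  open SchemeFacts sch using (diagonal; off-diagonal; row-sum-invariant; δ-diagonal)

  n : ℕ
  n = suc (suc m)

  E : Mat n
  E x y = sgn (F x y)

  E-skew : Skew E
  E-skew x y = trans (cong sgn (F-flip x y)) (sgn-swap (F x y))

  E-rows : RowsZero E
  E-rows = skew-rows-zero E E-skew (λ x → row-sum-invariant sgn x zero)

  E-cols : ∀ y → sum (λ x → E x y) ≡ 0ℤ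
  E-cols = skew-cols-zero E-skew E-rows

  -- E² is constant on the diagonal ...
  square-diagonal : ∀ x → (E ⊛ E) x x ≡ 1ℤ - + n
  square-diagonal x = begin
    sum (λ z → E x z * E z x)               ≡⟨ sum-cong entry ⟩
    sum (λ z → δ x z + - 1ℤ)                ≡⟨ sum-+ (δ x) (λ _ → - 1ℤ) ⟩
    sum (δ x) + sum {n} (λ _ → - 1ℤ)        ≡⟨ cong₂ _+_ (sum-δ-one x) (sum-const {n} (- 1ℤ)) ⟩
    1ℤ + + n * - 1ℤ                         ≡⟨ cong (λ t → 1ℤ + t) (trans (*-comm (+ n) (- 1ℤ)) (-1*i≡-i (+ n))) ⟩
    1ℤ - + n                                ∎
    where
    open ≡-Reasoning
    entry : ∀ z → E x z * E z x ≡ δ x z + - 1ℤ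
    entry z = trans (cong (λ t → E x z * sgn t) (F-flip x z))
                    (trans (sgn-return (F x z)) (cong (_- 1ℤ) (sym (δ-diagonal x z))))

  -- ... and off it, since E² is a class function that is symmetric.
  square-off-diagonal : ∀ {x y x' y'} → ¬ x ≡ y → ¬ x' ≡ y' → (E ⊛ E) x y ≡ (E ⊛ E) x' y'
  square-off-diagonal {x} {y} {x'} {y'} x≢y x'≢y' with nonzero-classes (F x y) (F x' y') (x≢y ∘ off-diagonal) (x'≢y' ∘ off-diagonal)
  ... | inj₁ same = two-step-invariant sch (λ i j → sgn i * sgn j) (sym same)
  ... | inj₂ transposed =
    trans (sym (skew-⊛-transpose E-skew E-skew x y))
          (two-step-invariant sch (λ i j → sgn i * sgn j) (trans (F-flip x y) (sym transposed)))

  -- E² = J - n I: the off-diagonal value c is forced to be 1 since the rows of E² sum to 0.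
  square : ∀ x y → (E ⊛ E) x y ≡ 1ℤ - + n * δ x y
  square x y = trans (shape x y) (trans (cong (λ t → t + ((1ℤ - + n) - t) * δ x y) c≡1) (finish (+ n) (δ x y)))
    where
    c : ℤ
    c = (E ⊛ E) zero (suc zero)
    shape : ∀ x y → (E ⊛ E) x y ≡ c + ((1ℤ - + n) - c) * δ x y
    shape = diag-offdiag (E ⊛ E) square-diagonal (λ x≢y → square-off-diagonal x≢y (λ ()))
    rows : + n * c + ((1ℤ - + n) - c) ≡ 0ℤ
    rows = trans (sym (trans (sum-cong (shape zero)) (row-sum-diag-offdiag {n} (1ℤ - + n) c zero))) (rows-zero-⊛ E {E} E-rows zero)
    c≡1 : c ≡ 1ℤ
    c≡1 = trans (sym (shift c)) (cong (_+ 1ℤ) (cancel-pos m (c - 1ℤ) (trans (factor (+ suc m) c) rows)))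
      where
      factor : ∀ k c → k * (c - 1ℤ) ≡ (1ℤ + k) * c + ((1ℤ - (1ℤ + k)) - c)
      factor = solve-∀
      shift : ∀ c → (c - 1ℤ) + 1ℤ ≡ c
      shift = solve-∀
    finish : ∀ k d → 1ℤ + ((1ℤ - k) - 1ℤ) * d ≡ 1ℤ - k * d
    finish = solve-∀

  -- Counting with (J + E)² = (2A₁ + I)² along an arc (x, y) gives n + 1 = 4 λ + 4,
  -- where λ is the number of two-step paths x → z → y.
  order-mod-4 : ∃ λ q → n ≡ 4 ℕ.* q ℕ.+ 3
  order-mod-4 with IsScheme.nonempty sch (suc zero)
  ... | x , y , Fxy≡1 = ∣ paths ∣ , +-injective (begin
    + n                       ≡⟨ sym (shift (+ n)) ⟩
    (+ n + 1ℤ) - 1ℤ           ≡⟨ cong (_- 1ℤ) (trans (sym via-E) via-arcs) ⟩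
    + 4 * paths + + 4 - 1ℤ    ≡⟨ shift′ paths ⟩
    + 4 * paths + + 3         ≡⟨ cong (λ t → + 4 * t + + 3) (sym (0≤i⇒+∣i∣≡i paths≥0)) ⟩
    + 4 * + ∣ paths ∣ + + 3   ≡⟨ cong (_+ + 3) (sym (pos-* 4 ∣ paths ∣)) ⟩
    + (4 ℕ.* ∣ paths ∣) + + 3 ≡⟨ sym (pos-+ (4 ℕ.* ∣ paths ∣) 3) ⟩
    + (4 ℕ.* ∣ paths ∣ ℕ.+ 3) ∎)
    where
    open ≡-Reasoning
    x≢y : ¬ x ≡ y
    x≢y refl = case (trans (sym (diagonal x)) Fxy≡1)
      where case : ¬ (Fin.zero {2} ≡ suc zero)
            case ()
    U : Mat n
    U u v = + 2 * arc (F u v)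
    paths : ℤ
    paths = sum (λ z → arc (F x z) * arc (F z y))
    paths≥0 : 0ℤ ≤ paths
    paths≥0 = sum-nonneg _ (λ z → arc² (F x z) (F z y))
      where arc² : ∀ i j → 0ℤ ≤ arc i * arc j
            arc² zero j = ℤ.+≤+ ℕ.z≤n
            arc² (suc zero) zero = ℤ.+≤+ ℕ.z≤n
            arc² (suc zero) (suc zero) = ℤ.+≤+ ℕ.z≤n
            arc² (suc zero) (suc (suc zero)) = ℤ.+≤+ ℕ.z≤n
            arc² (suc (suc zero)) j = ℤ.+≤+ ℕ.z≤n
    J+E≡2A+I : ∀ u v → 1ℤ + E u v ≡ U u v + δ u v
    J+E≡2A+I u v = trans (sgn-arc (F u v)) (cong (λ t → U u v + t) (sym (δ-diagonal u v)))
    via-E : sum (λ z → (1ℤ + E x z) * (1ℤ + E z y)) ≡ + n + 1ℤ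
    via-E = trans (⊛-plus-ones E E x y)
      (trans (cong₂ (λ s t → + n + s + t + (E ⊛ E) x y) (E-rows x) (E-cols y))
      (trans (cong (λ t → + n + 0ℤ + 0ℤ + t) (trans (square x y) (cong (λ t → 1ℤ - + n * t) (δ-≢ x≢y))))
             (simplify (+ n))))
      where simplify : ∀ k → k + 0ℤ + 0ℤ + (1ℤ - k * 0ℤ) ≡ k + 1ℤ
            simplify = solve-∀
    via-arcs : sum (λ z → (1ℤ + E x z) * (1ℤ + E z y)) ≡ + 4 * paths + + 4
    via-arcs = trans (sum-cong (λ z → cong₂ _*_ (J+E≡2A+I x z) (J+E≡2A+I z y)))
      (trans (⊛-plus-identity U U x y)
      (trans (cong₂ (λ s t → s + t + t + δ x y) (trans (sum-cong (λ z → quadruple (arc (F x z)) (arc (F z y))))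
                                                      (sum-*ˡ (+ 4) (λ z → arc (F x z) * arc (F z y))))
                                               (cong (λ i → + 2 * arc i) Fxy≡1))
             (trans (cong (λ t → + 4 * paths + + 2 + + 2 + t) (δ-≢ x≢y)) (collect paths))))
      where
      collect : ∀ p → + 4 * p + + 2 + + 2 + 0ℤ ≡ + 4 * p + + 4
      collect = solve-∀
      quadruple : ∀ a b → (+ 2 * a) * (+ 2 * b) ≡ + 4 * (a * b)
      quadruple = solve-∀
    shift : ∀ k → (k + 1ℤ) - 1ℤ ≡ k
    shift = solve-∀
    shift′ : ∀ p → + 4 * p + + 4 - 1ℤ ≡ + 4 * p + + 3
    shift′ = solve-∀

-- The feasibility condition: from n = 1 + N + N₂, -N + bN + cN₂ = 0 and N² + b²N + c²N₂ = nN
-- with N₂ ≠ 0 one gets N₂ (c²(N + N₂) - N² - 2Nc) = 0, that is (N + c)² = n c².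
feasibility : ∀ {n N N₂ b c : ℤ} → 1ℤ ≤ N₂ → n ≡ 1ℤ + N + N₂ → - N + b * N + c * N₂ ≡ 0ℤ →
  N * N + b * b * N + c * c * N₂ ≡ n * N → (N + c) * (N + c) ≡ n * (c * c)
feasibility {n} {N} {N₂} {b} {c} N₂≥1 refl linear quadratic =
  trans (complete-square N N₂ c) (trans (cong (λ t → (1ℤ + N + N₂) * (c * c) - t) W≡0) (+-identityʳ _))
  where
  W : ℤ
  W = c * c * (N + N₂) - N * N - + 2 * N * c
  key : ∀ N N₂ b c → N * ((N * N + b * b * N + c * c * N₂) - (1ℤ + N + N₂) * N)
      ≡ N₂ * (c * c * (N + N₂) - N * N - + 2 * N * c) + (- N + b * N + c * N₂) * (+ 2 * N - + 2 * c * N₂ + (- N + b * N + c * N₂))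
  key = solve-∀
  N₂W≡0 : N₂ * W ≡ 0ℤ
  N₂W≡0 = begin
    N₂ * W                                                        ≡⟨ sym (+-identityʳ _) ⟩
    N₂ * W + 0ℤ                                                   ≡⟨ cong (λ t → N₂ * W + t) (sym (*-zeroˡ (+ 2 * N - + 2 * c * N₂ + 0ℤ))) ⟩
    N₂ * W + 0ℤ * (+ 2 * N - + 2 * c * N₂ + 0ℤ)                   ≡⟨ cong (λ t → N₂ * W + t * (+ 2 * N - + 2 * c * N₂ + t)) (sym linear) ⟩
    N₂ * W + (- N + b * N + c * N₂) * (+ 2 * N - + 2 * c * N₂ + (- N + b * N + c * N₂)) ≡⟨ sym (key N N₂ b c) ⟩
    N * ((N * N + b * b * N + c * c * N₂) - (1ℤ + N + N₂) * N)    ≡⟨ cong (λ t → N * (t - (1ℤ + N + N₂) * N)) quadratic ⟩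
    N * ((1ℤ + N + N₂) * N - (1ℤ + N + N₂) * N)                   ≡⟨ cong (N *_) (+-inverseʳ ((1ℤ + N + N₂) * N)) ⟩
    N * 0ℤ                                                        ≡⟨ *-zeroʳ N ⟩
    0ℤ                                                            ∎
    where open ≡-Reasoning
  W≡0 : W ≡ 0ℤ
  W≡0 = positive-factor N₂≥1 (trans (*-comm W N₂) N₂W≡0)
  complete-square : ∀ N N₂ c → (N + c) * (N + c) ≡ (1ℤ + N + N₂) * (c * c) - (c * c * (N + N₂) - N * N - + 2 * N * c)
  complete-square = solve-∀

open Squares using (no-square)

nonzero-case : ∀ q {N c : ℤ} → ¬ ∣ c ∣ ≡ 0 → ¬ ((N + c) * (N + c) ≡ + (4 ℕ.* q ℕ.+ 3) * (c * c))
nonzero-case q {N} {c} ∣c∣≢0 eq = no-square q ∣ c ∣ ∣ N + c ∣ ∣c∣≢0 (begin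
  ∣ N + c ∣ ℕ.* ∣ N + c ∣                ≡⟨ abs-* (N + c) (N + c) ⟨
  ∣ (N + c) * (N + c) ∣                  ≡⟨ cong ∣_∣ eq ⟩
  ∣ + (4 ℕ.* q ℕ.+ 3) * (c * c) ∣        ≡⟨ abs-* (+ (4 ℕ.* q ℕ.+ 3)) (c * c) ⟩
  (4 ℕ.* q ℕ.+ 3) ℕ.* ∣ c * c ∣          ≡⟨ cong ((4 ℕ.* q ℕ.+ 3) ℕ.*_) (abs-* c c) ⟩
  (4 ℕ.* q ℕ.+ 3) ℕ.* (∣ c ∣ ℕ.* ∣ c ∣)  ∎)
  where open ≡-Reasoning

not-a-square : ∀ q {N c : ℤ} → 1ℤ ≤ N → ¬ ((N + c) * (N + c) ≡ + (4 ℕ.* q ℕ.+ 3) * (c * c))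
not-a-square q {N} {+ zero} N≥1 eq = 1≰0 (subst (1ℤ ≤_) N≡0 N≥1)
  where
  N≡0 : N ≡ 0ℤ
  N≡0 with i*j≡0⇒i≡0∨j≡0 (N + 0ℤ) (trans eq (*-zeroʳ (+ (4 ℕ.* q ℕ.+ 3))))
  ... | inj₁ N+0≡0 = trans (sym (+-identityʳ N)) N+0≡0
  ... | inj₂ N+0≡0 = trans (sym (+-identityʳ N)) N+0≡0
not-a-square q {N} {c@(+ suc _)} N≥1 eq = nonzero-case q {N} {c} (λ ()) eq
not-a-square q {N} {c@(-[1+ _ ])} N≥1 eq = nonzero-case q {N} {c} (λ ()) eq

-- Orientation of a pair of class indices: 1 if a < b, 2 if a > b, 0 if a = b.  Applied to
-- (β, β') it picks one class out of each transposed pair of a skew-symmetric scheme.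
side : ∀ {k} → Fin k → Fin k → Fin 3
side a b with F.<-cmp a b
... | tri< _ _ _ = suc zero
... | tri≈ _ _ _ = zero
... | tri> _ _ _ = suc (suc zero)

side-swap : ∀ {k} (a b : Fin k) → side b a ≡ swap₃ (side a b)
side-swap a b with F.<-cmp a b | F.<-cmp b a
... | tri< _ _ _ | tri> _ _ _ = refl
... | tri≈ _ _ _ | tri≈ _ _ _ = refl
... | tri> _ _ _ | tri< _ _ _ = refl
... | tri< _ _ ¬b<a | tri< b<a _ _ = ⊥-elim (¬b<a b<a)
... | tri< _ a≢b _ | tri≈ _ b≡a _ = ⊥-elim (a≢b (sym b≡a))
... | tri≈ _ a≡b _ | tri< _ b≢a _ = ⊥-elim (b≢a (sym a≡b))
... | tri≈ _ a≡b _ | tri> _ b≢a _ = ⊥-elim (b≢a (sym a≡b))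
... | tri> _ a≢b _ | tri≈ _ b≡a _ = ⊥-elim (a≢b (sym b≡a))
... | tri> ¬a<b _ _ | tri> _ _ a<b = ⊥-elim (¬a<b a<b)

side-zero : ∀ {k} (a b : Fin k) → side a b ≡ zero → a ≡ b
side-zero a b eq with F.<-cmp a b
side-zero a b () | tri< _ _ _
... | tri≈ _ a≡b _ = a≡b
side-zero a b () | tri> _ _ _

side-refl : ∀ {k} (a : Fin k) → side a a ≡ zero
side-refl a with F.<-cmp a a
... | tri< a<a _ _ = ⊥-elim (F.<-irrefl refl a<a)
... | tri≈ _ _ _ = refl
... | tri> _ _ a<a = ⊥-elim (F.<-irrefl refl a<a)

side-< : ∀ {k} {a b : Fin k} → a <ᶠ b → side a b ≡ suc zero
side-< {a = a} {b} a<b with F.<-cmp a b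
... | tri< _ _ _ = refl
... | tri≈ ¬a<b _ _ = ⊥-elim (¬a<b a<b)
... | tri> ¬a<b _ _ = ⊥-elim (¬a<b a<b)

-- The index set of the five-class fusion {0}, {α}, {α'}, P, P', where P ∪ P' are the remaining
-- classes, each pair {β, β'} split by orientation.  combine p o is the class of an index with
-- orientation o that lies in {α, α'} (p = true) or not.

swap₅ : Fin 5 → Fin 5
swap₅ zero = zero
swap₅ (suc zero) = suc (suc zero)
swap₅ (suc (suc zero)) = suc zero
swap₅ (suc (suc (suc zero))) = suc (suc (suc (suc zero)))
swap₅ (suc (suc (suc (suc zero)))) = suc (suc (suc zero))

swap₅-involutive : ∀ k → swap₅ (swap₅ k) ≡ k
swap₅-involutive zero = refl
swap₅-involutive (suc zero) = refl
swap₅-involutive (suc (suc zero)) = refl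
swap₅-involutive (suc (suc (suc zero))) = refl
swap₅-involutive (suc (suc (suc (suc zero)))) = refl

combine : Bool → Fin 3 → Fin 5
combine _ zero = zero
combine true (suc zero) = suc zero
combine true (suc (suc zero)) = suc (suc zero)
combine false (suc zero) = suc (suc (suc zero))
combine false (suc (suc zero)) = suc (suc (suc (suc zero)))

combine-swap : ∀ p o → combine p (swap₃ o) ≡ swap₅ (combine p o)
combine-swap p zero = refl
combine-swap true (suc zero) = refl
combine-swap true (suc (suc zero)) = refl
combine-swap false (suc zero) = refl
combine-swap false (suc (suc zero)) = refl

combine-zero : ∀ p o → combine p o ≡ zero → o ≡ zero
combine-zero p zero _ = refl
combine-zero true (suc zero) ()
combine-zero true (suc (suc zero)) ()
combine-zero false (suc zero) ()
combine-zero false (suc (suc zero)) ()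

one<other : ∀ {k} (b : Fin (suc (suc k))) → ¬ b ≡ zero → ¬ b ≡ suc zero → Fin.suc {suc k} zero <ᶠ b
one<other zero b≢0 _ = ⊥-elim (b≢0 refl)
one<other (suc zero) _ b≢1 = ⊥-elim (b≢1 refl)
one<other (suc (suc b)) _ _ = ℕ.s≤s (ℕ.s≤s ℕ.z≤n)

-- The two three-class fusions of the five-class fusion: μ₊ merges {α} with P and {α'} with P',
-- μ₋ merges {α} with P' and {α'} with P.
μ₊ μ₋ : Fin 5 → Fin 3
μ₊ zero = zero
μ₊ (suc zero) = suc zero
μ₊ (suc (suc zero)) = suc (suc zero)
μ₊ (suc (suc (suc zero))) = suc zero
μ₊ (suc (suc (suc (suc zero)))) = suc (suc zero)
μ₋ zero = zero
μ₋ (suc zero) = suc zero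
μ₋ (suc (suc zero)) = suc (suc zero)
μ₋ (suc (suc (suc zero))) = suc (suc zero)
μ₋ (suc (suc (suc (suc zero)))) = suc zero

μ₊-map : FusionMap swap₅ swap₃ μ₊
μ₊-map = record
  { onto      = λ { zero → zero , refl ; (suc zero) → suc zero , refl ; (suc (suc zero)) → suc (suc zero) , refl }
  ; zero-iff  = λ { zero → mk⇔ (λ _ → refl) (λ _ → refl)
                  ; (suc zero) → mk⇔ (λ ()) (λ ())
                  ; (suc (suc zero)) → mk⇔ (λ ()) (λ ())
                  ; (suc (suc (suc zero))) → mk⇔ (λ ()) (λ ())
                  ; (suc (suc (suc (suc zero)))) → mk⇔ (λ ()) (λ ()) }
  ; intertwin = λ { zero → refl ; (suc zero) → refl ; (suc (suc zero)) → refl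
                  ; (suc (suc (suc zero))) → refl ; (suc (suc (suc (suc zero)))) → refl }
  }

μ₋-map : FusionMap swap₅ swap₃ μ₋
μ₋-map = record
  { onto      = λ { zero → zero , refl ; (suc zero) → suc zero , refl ; (suc (suc zero)) → suc (suc zero) , refl }
  ; zero-iff  = λ { zero → mk⇔ (λ _ → refl) (λ _ → refl)
                  ; (suc zero) → mk⇔ (λ ()) (λ ())
                  ; (suc (suc zero)) → mk⇔ (λ ()) (λ ())
                  ; (suc (suc (suc zero))) → mk⇔ (λ ()) (λ ())
                  ; (suc (suc (suc (suc zero)))) → mk⇔ (λ ()) (λ ()) }
  ; intertwin = λ { zero → refl ; (suc zero) → refl ; (suc (suc zero)) → refl
                  ; (suc (suc (suc zero))) → refl ; (suc (suc (suc (suc zero)))) → refl }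
  }

fin5-cases : {P : Fin 5 → Set} → P zero → P (suc zero) → P (suc (suc zero)) →
  P (suc (suc (suc zero))) → P (suc (suc (suc (suc zero)))) → ∀ k → P k
fin5-cases p₀ p₁ p₂ p₃ p₄ zero = p₀
fin5-cases p₀ p₁ p₂ p₃ p₄ (suc zero) = p₁
fin5-cases p₀ p₁ p₂ p₃ p₄ (suc (suc zero)) = p₂
fin5-cases p₀ p₁ p₂ p₃ p₄ (suc (suc (suc zero))) = p₃
fin5-cases p₀ p₁ p₂ p₃ p₄ (suc (suc (suc (suc zero)))) = p₄

-- s₁ is the sign pattern of {α, α'}, s₂ that of P ∪ P'; D, U₁, U₂ are the indicators of
-- {0}, {α, α'} and P ∪ P'.
s₁ s₂ D U₁ U₂ : Fin 5 → ℤ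
s₁ = fin5-cases 0ℤ 1ℤ (- 1ℤ) 0ℤ 0ℤ
s₂ = fin5-cases 0ℤ 0ℤ 0ℤ 1ℤ (- 1ℤ)
D  = fin5-cases 1ℤ 0ℤ 0ℤ 0ℤ 0ℤ
U₁ = fin5-cases 0ℤ 1ℤ 1ℤ 0ℤ 0ℤ
U₂ = fin5-cases 0ℤ 0ℤ 0ℤ 1ℤ 1ℤ

s₁-swap : ∀ k → s₁ (swap₅ k) ≡ - s₁ k
s₁-swap = fin5-cases refl refl refl refl refl

s₂-swap : ∀ k → s₂ (swap₅ k) ≡ - s₂ k
s₂-swap = fin5-cases refl refl refl refl refl

sgn-μ₊ : ∀ k → sgn (μ₊ k) ≡ s₁ k + s₂ k
sgn-μ₊ = fin5-cases refl refl refl refl refl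

sgn-μ₋ : ∀ k → sgn (μ₋ k) ≡ s₁ k - s₂ k
sgn-μ₋ = fin5-cases refl refl refl refl refl

s₁-square : ∀ k → s₁ k * s₁ k ≡ U₁ k
s₁-square = fin5-cases refl refl refl refl refl

s₂-square : ∀ k → s₂ k * s₂ k ≡ U₂ k
s₂-square = fin5-cases refl refl refl refl refl

s₁-s₂-disjoint : ∀ k → s₁ k * s₂ k ≡ 0ℤ
s₁-s₂-disjoint = fin5-cases refl refl refl refl refl

D-diagonal : ∀ k → D k ≡ ind ⌊ k ≟ zero ⌋
D-diagonal = fin5-cases refl refl refl refl refl

partition : ∀ k → D k + U₁ k + U₂ k ≡ 1ℤ
partition = fin5-cases refl refl refl refl refl

U₁-nonneg : ∀ k → 0ℤ ≤ U₁ k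
U₁-nonneg = fin5-cases (ℤ.+≤+ ℕ.z≤n) (ℤ.+≤+ ℕ.z≤n) (ℤ.+≤+ ℕ.z≤n) (ℤ.+≤+ ℕ.z≤n) (ℤ.+≤+ ℕ.z≤n)

U₂-nonneg : ∀ k → 0ℤ ≤ U₂ k
U₂-nonneg = fin5-cases (ℤ.+≤+ ℕ.z≤n) (ℤ.+≤+ ℕ.z≤n) (ℤ.+≤+ ℕ.z≤n) (ℤ.+≤+ ℕ.z≤n) (ℤ.+≤+ ℕ.z≤n)

-- D, U₁, U₂ are orthogonal idempotents, so squaring a combination squares its coefficients.
square-combination : ∀ k a b c →
  (a * D k + b * U₁ k + c * U₂ k) * (a * D k + b * U₁ k + c * U₂ k) ≡ a * a * D k + b * b * U₁ k + c * c * U₂ k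
square-combination = fin5-cases on-D on-U₁ on-U₁ on-U₂ on-U₂
  where
  on-D : ∀ a b c → (a * 1ℤ + b * 0ℤ + c * 0ℤ) * (a * 1ℤ + b * 0ℤ + c * 0ℤ) ≡ a * a * 1ℤ + b * b * 0ℤ + c * c * 0ℤ
  on-D = solve-∀
  on-U₁ : ∀ a b c → (a * 0ℤ + b * 1ℤ + c * 0ℤ) * (a * 0ℤ + b * 1ℤ + c * 0ℤ) ≡ a * a * 0ℤ + b * b * 1ℤ + c * c * 0ℤ
  on-U₁ = solve-∀
  on-U₂ : ∀ a b c → (a * 0ℤ + b * 0ℤ + c * 1ℤ) * (a * 0ℤ + b * 0ℤ + c * 1ℤ) ≡ a * a * 0ℤ + b * b * 0ℤ + c * c * 1ℤ
  on-U₂ = solve-∀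

module SkewAmorphous {m d : ℕ} (r : RelAssign (suc (suc m)) (suc (suc (suc d))))
  (sch : IsScheme r) (skew : SkewSymmetric r) (amorphous : Amorphous r) where

  open SchemeFacts sch

  n : ℕ
  n = suc (suc m)

  tr-fixed : ∀ β → tr β ≡ β → β ≡ zero
  tr-fixed β eq = skew β (subst (IsTranspose r β) eq (proj₂ (IsScheme.transposes sch β)))

  orient : Class → Fin 3
  orient β = side β (tr β)

  orient-tr : ∀ β → orient (tr β) ≡ swap₃ (orient β)
  orient-tr β = trans (cong (side (tr β)) (tr-involutive β)) (side-swap β (tr β))

  orient-zero : ∀ β → orient β ≡ zero → β ≡ zero
  orient-zero β eq = tr-fixed β (sym (side-zero β (tr β) eq))

  α : Class
  α = suc zero

  α≢0 : ¬ α ≡ zero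
  α≢0 ()

  two three : Class
  two = suc (suc zero)
  three = suc (suc (suc zero))

  α<α' : α <ᶠ tr α
  α<α' = one<other (tr α) (λ eq → α≢0 (trans (sym (tr-involutive α)) (trans (cong tr eq) tr-zero)))
                          (λ eq → α≢0 (tr-fixed α eq))

  paired : Class → Bool
  paired β = ⌊ β ≟ α ⌋ ∨ ⌊ tr β ≟ α ⌋

  paired-tr : ∀ β → paired (tr β) ≡ paired β
  paired-tr β = trans (cong (λ t → ⌊ tr β ≟ α ⌋ ∨ ⌊ t ≟ α ⌋) (tr-involutive β)) (∨-comm ⌊ tr β ≟ α ⌋ ⌊ β ≟ α ⌋)

  L : Class → Fin 5
  L β = combine (paired β) (orient β)

  L-tr : ∀ β → L (tr β) ≡ swap₅ (L β)
  L-tr β = trans (cong₂ combine (paired-tr β) (orient-tr β)) (combine-swap (paired β) (orient β))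

  L-α : L α ≡ suc zero
  L-α with α ≟ α
  ... | no α≢α = ⊥-elim (α≢α refl)
  ... | yes _ = cong (combine true) (side-< α<α')

  unpaired-if : ∀ {β} → ¬ β ≡ α → ¬ tr β ≡ α → paired β ≡ false
  unpaired-if {β} β≢α β'≢α with β ≟ α | tr β ≟ α
  ... | yes eq | _ = ⊥-elim (β≢α eq)
  ... | no _ | yes eq = ⊥-elim (β'≢α eq)
  ... | no _ | no _ = refl

  -- An index outside {0, α, α'}: one of 2 and 3 will do, as α' is at most one of them.
  unpaired : ∃ λ β → paired β ≡ false × ¬ β ≡ zero
  unpaired with tr two ≟ α
  ... | no two'≢α = two , unpaired-if (λ ()) two'≢α , (λ ())
  ... | yes two'≡α = three , unpaired-if (λ ()) (λ eq → two≢three (tr-injective (trans two'≡α (sym eq)))) , (λ ())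
    where two≢three : ¬ two ≡ three
          two≢three ()

  L-zero : L zero ≡ zero
  L-zero = cong (combine (paired zero)) (trans (cong (side zero) tr-zero) (side-refl {suc (suc (suc (suc d)))} zero))

  -- The classes P and P' are nonempty: they contain an unpaired index or its transpose.
  L-onto-P : ∀ i → (i ≡ suc (suc (suc zero))) ⊎ (i ≡ suc (suc (suc (suc zero)))) → ∃ λ β → L β ≡ i
  L-onto-P i i∈P with unpaired
  ... | β , unpaired-β , β≢0 with orient β in orient-β | i∈P
  ...   | zero | _ = ⊥-elim (β≢0 (orient-zero β orient-β))
  ...   | suc zero | inj₁ refl = β , cong₂ combine unpaired-β orient-β
  ...   | suc zero | inj₂ refl = tr β , trans (L-tr β) (cong swap₅ (cong₂ combine unpaired-β orient-β))
  ...   | suc (suc zero) | inj₁ refl = tr β , trans (L-tr β) (cong swap₅ (cong₂ combine unpaired-β orient-β))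
  ...   | suc (suc zero) | inj₂ refl = β , cong₂ combine unpaired-β orient-β

  L-map : FusionMap tr swap₅ L
  L-map = record
    { onto      = λ { zero → zero , L-zero
                    ; (suc zero) → α , L-α
                    ; (suc (suc zero)) → tr α , trans (L-tr α) (cong swap₅ L-α)
                    ; (suc (suc (suc zero))) → L-onto-P _ (inj₁ refl)
                    ; (suc (suc (suc (suc zero)))) → L-onto-P _ (inj₂ refl) }
    ; zero-iff  = λ β → mk⇔ (λ eq → orient-zero β (combine-zero (paired β) (orient β) eq))
                           (λ { refl → L-zero })
    ; intertwin = L-tr
    }

  R : RelAssign n 4
  R = fuse r L

  R-scheme : IsScheme R
  R-scheme = amorphous 4 L (admissible sch swap₅-involutive L-map)

  R-flip : ∀ x y → R y x ≡ swap₅ (R x y)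
  R-flip x y = trans (cong L (flip x y)) (L-tr (r x y))

  tournament : ∀ {μ} → FusionMap swap₅ swap₃ μ → IsScheme (fuse r (μ ∘ L))
  tournament μ-map = amorphous 2 _ (admissible sch swap₃-involutive (compose L-map μ-map))

  tournament-flip : ∀ {μ} → FusionMap swap₅ swap₃ μ → ∀ x y → μ (R y x) ≡ swap₃ (μ (R x y))
  tournament-flip {μ} μ-map x y = trans (cong μ (R-flip x y)) (FusionMap.intertwin μ-map (R x y))

  module T₊ = Tournament (fuse r (μ₊ ∘ L)) (tournament μ₊-map) (tournament-flip μ₊-map)
  module T₋ = Tournament (fuse r (μ₋ ∘ L)) (tournament μ₋-map) (tournament-flip μ₋-map)

  open SchemeFacts R-scheme using ()
    renaming (row-sum-invariant to R-row-sum-invariant; δ-diagonal to R-δ-diagonal;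
              diagonal to R-diagonal; off-diagonal to R-off-diagonal)

  E₁ E₂ : Mat n
  E₁ x y = s₁ (R x y)
  E₂ x y = s₂ (R x y)

  E₁-skew : Skew E₁
  E₁-skew x y = trans (cong s₁ (R-flip x y)) (s₁-swap (R x y))

  E₂-skew : Skew E₂
  E₂-skew x y = trans (cong s₂ (R-flip x y)) (s₂-swap (R x y))

  E₁-rows : RowsZero E₁
  E₁-rows = skew-rows-zero E₁ E₁-skew (λ x → R-row-sum-invariant s₁ x zero)

  -- E₁ ± E₂ are the signed adjacency matrices of the tournaments, so both square to J - n I;
  -- adding and subtracting, E₁² + E₂² = J - n I and E₁ E₂ + E₂ E₁ = 0.
  tournament₊-square : ∀ x y → ((E₁ ⊛ E₁) x y + (E₂ ⊛ E₂) x y) + ((E₁ ⊛ E₂) x y + (E₂ ⊛ E₁) x y) ≡ 1ℤ - + n * δ x y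
  tournament₊-square x y =
    trans (sym (⊛-square-⊞ E₁ E₂ x y)) (trans (⊛-cong signs signs x y) (T₊.square x y))
    where signs : ∀ x y → (E₁ ⊞ E₂) x y ≡ T₊.E x y
          signs x y = sym (sgn-μ₊ (R x y))

  tournament₋-square : ∀ x y → ((E₁ ⊛ E₁) x y + (E₂ ⊛ E₂) x y) - ((E₁ ⊛ E₂) x y + (E₂ ⊛ E₁) x y) ≡ 1ℤ - + n * δ x y
  tournament₋-square x y =
    trans (sym (⊛-square-⊟ E₁ E₂ x y)) (trans (⊛-cong signs signs x y) (T₋.square x y))
    where signs : ∀ x y → (E₁ ⊟ E₂) x y ≡ T₋.E x y
          signs x y = sym (sgn-μ₋ (R x y))

  anticommute : ∀ x y → (E₁ ⊛ E₂) x y + (E₂ ⊛ E₁) x y ≡ 0ℤ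
  anticommute x y = plus-minus ((E₁ ⊛ E₁) x y + (E₂ ⊛ E₂) x y) ((E₁ ⊛ E₂) x y + (E₂ ⊛ E₁) x y) (1ℤ - + n * δ x y) (tournament₊-square x y) (tournament₋-square x y)

  squares-sum : ∀ x y → (E₁ ⊛ E₁) x y + (E₂ ⊛ E₂) x y ≡ 1ℤ - + n * δ x y
  squares-sum x y = trans (sym (+-identityʳ _)) (trans (cong (λ t → (E₁ ⊛ E₁) x y + (E₂ ⊛ E₂) x y + t) (sym (anticommute x y))) (tournament₊-square x y))

  ClassFunction : Mat n → Set
  ClassFunction K = ∀ {x y x' y'} → R x y ≡ R x' y' → K x y ≡ K x' y'

  product-class : ∀ (s t : Fin 5 → ℤ) → ClassFunction ((λ x y → s (R x y)) ⊛ (λ x y → t (R x y)))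
  product-class s t = two-step-invariant R-scheme (λ i j → s i * t j)

  x₁ y₁ x₃ y₃ : Fin n
  x₁ = proj₁ (IsScheme.nonempty R-scheme (suc zero))
  y₁ = proj₁ (proj₂ (IsScheme.nonempty R-scheme (suc zero)))
  x₃ = proj₁ (IsScheme.nonempty R-scheme (suc (suc (suc zero))))
  y₃ = proj₁ (proj₂ (IsScheme.nonempty R-scheme (suc (suc (suc zero)))))

  R-x₁y₁ : R x₁ y₁ ≡ suc zero
  R-x₁y₁ = proj₂ (proj₂ (IsScheme.nonempty R-scheme (suc zero)))

  R-x₃y₃ : R x₃ y₃ ≡ suc (suc (suc zero))
  R-x₃y₃ = proj₂ (proj₂ (IsScheme.nonempty R-scheme (suc (suc (suc zero)))))

  -- A class function is determined by its values on the diagonal and on the representatives;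
  -- on the transposed classes α' and P' its value follows from (anti)symmetry.
  expand-skew : ∀ {K} → ClassFunction K → Skew K → ∀ x y → K x y ≡ K x₁ y₁ * E₁ x y + K x₃ y₃ * E₂ x y
  expand-skew {K} class skewK x y = by-class (R x y) refl
    where
    a b : ℤ
    a = K x₁ y₁
    b = K x₃ y₃
    vanishes-on-diagonal : ∀ {x y} → x ≡ y → K x y ≡ 0ℤ
    vanishes-on-diagonal {x} refl = self-neg (K x x) (skewK x x)
    transposed : ∀ {k x' y'} → R x y ≡ k → R x' y' ≡ swap₅ k → K x y ≡ - K x' y'
    transposed {k} Rxy≡k Rx'y'≡k' = trans (sym (neg-involutive (K x y)))
      (cong -_ (trans (sym (skewK x y)) (class (trans (R-flip x y) (trans (cong swap₅ Rxy≡k) (sym Rx'y'≡k'))))))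
    on-0 : ∀ a b → 0ℤ ≡ a * 0ℤ + b * 0ℤ
    on-0 = solve-∀
    on-1 : ∀ a b → a ≡ a * 1ℤ + b * 0ℤ
    on-1 = solve-∀
    on-2 : ∀ a b → - a ≡ a * - 1ℤ + b * 0ℤ
    on-2 = solve-∀
    on-3 : ∀ a b → b ≡ a * 0ℤ + b * 1ℤ
    on-3 = solve-∀
    on-4 : ∀ a b → - b ≡ a * 0ℤ + b * - 1ℤ
    on-4 = solve-∀
    by-class : ∀ k → R x y ≡ k → K x y ≡ a * s₁ k + b * s₂ k
    by-class zero Rxy≡0 = trans (vanishes-on-diagonal (R-off-diagonal Rxy≡0)) (on-0 a b)
    by-class (suc zero) Rxy≡1 = trans (class (trans Rxy≡1 (sym R-x₁y₁))) (on-1 a b)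
    by-class (suc (suc zero)) Rxy≡2 = trans (transposed Rxy≡2 R-x₁y₁) (on-2 a b)
    by-class (suc (suc (suc zero))) Rxy≡3 = trans (class (trans Rxy≡3 (sym R-x₃y₃))) (on-3 a b)
    by-class (suc (suc (suc (suc zero)))) Rxy≡4 = trans (transposed Rxy≡4 R-x₃y₃) (on-4 a b)

  expand-symmetric : ∀ {K} → ClassFunction K → (∀ x y → K y x ≡ K x y) →
    ∀ x y → K x y ≡ K x₁ x₁ * D (R x y) + K x₁ y₁ * U₁ (R x y) + K x₃ y₃ * U₂ (R x y)
  expand-symmetric {K} class symK x y = by-class (R x y) refl
    where
    a b c : ℤ
    a = K x₁ x₁
    b = K x₁ y₁
    c = K x₃ y₃
    transposed : ∀ {k x' y'} → R x y ≡ k → R x' y' ≡ swap₅ k → K x y ≡ K x' y'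
    transposed {k} Rxy≡k Rx'y'≡k' =
      trans (sym (symK x y)) (class (trans (R-flip x y) (trans (cong swap₅ Rxy≡k) (sym Rx'y'≡k'))))
    on-D : ∀ a b c → a ≡ a * 1ℤ + b * 0ℤ + c * 0ℤ
    on-D = solve-∀
    on-U₁ : ∀ a b c → b ≡ a * 0ℤ + b * 1ℤ + c * 0ℤ
    on-U₁ = solve-∀
    on-U₂ : ∀ a b c → c ≡ a * 0ℤ + b * 0ℤ + c * 1ℤ
    on-U₂ = solve-∀
    by-class : ∀ k → R x y ≡ k → K x y ≡ a * D k + b * U₁ k + c * U₂ k
    by-class zero Rxy≡0 = trans (class (trans Rxy≡0 (sym (R-diagonal x₁)))) (on-D a b c)
    by-class (suc zero) Rxy≡1 = trans (class (trans Rxy≡1 (sym R-x₁y₁))) (on-U₁ a b c)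
    by-class (suc (suc zero)) Rxy≡2 = trans (transposed Rxy≡2 R-x₁y₁) (on-U₁ a b c)
    by-class (suc (suc (suc zero))) Rxy≡3 = trans (class (trans Rxy≡3 (sym R-x₃y₃))) (on-U₂ a b c)
    by-class (suc (suc (suc (suc zero)))) Rxy≡4 = trans (transposed Rxy≡4 R-x₃y₃) (on-U₂ a b c)

  -- E₁ E₂ = 0.  It is skew (by anticommutativity) and a class function, hence equal to
  -- m₁ E₁ + m₃ E₂; the vanishing forms Σ_y E₁ (E₁ E₂) and Σ_x E₂ (E₁ E₂) then force m₁ = m₃ = 0.
  M : Mat n
  M = E₁ ⊛ E₂

  M-skew : Skew M
  M-skew x y = trans (skew-⊛-transpose E₁-skew E₂-skew x y) (other-summand (anticommute x y))
    where other-summand : ∀ {a b} → a + b ≡ 0ℤ → b ≡ - a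
          other-summand {a} {b} a+b≡0 = trans (isolate a b) (trans (cong (_- a) a+b≡0) (+-identityˡ (- a)))
            where isolate : ∀ a b → b ≡ (a + b) - a
                  isolate = solve-∀

  M-expansion : ∀ x y → M x y ≡ M x₁ y₁ * E₁ x y + M x₃ y₃ * E₂ x y
  M-expansion = expand-skew (product-class s₁ s₂) M-skew

  along-E₁ : ∀ k a b → s₁ k * (a * s₁ k + b * s₂ k) ≡ a * U₁ k
  along-E₁ k a b = trans (distribute (s₁ k) (s₂ k) a b)
    (trans (cong₂ (λ u v → a * u + b * v) (s₁-square k) (s₁-s₂-disjoint k)) (drop (a * U₁ k) b))
    where distribute : ∀ s t a b → s * (a * s + b * t) ≡ a * (s * s) + b * (s * t)
          distribute = solve-∀
          drop : ∀ u b → u + b * 0ℤ ≡ u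
          drop = solve-∀

  along-E₂ : ∀ k a b → s₂ k * (a * s₁ k + b * s₂ k) ≡ b * U₂ k
  along-E₂ k a b = trans (distribute (s₁ k) (s₂ k) a b)
    (trans (cong₂ (λ u v → a * u + b * v) (s₁-s₂-disjoint k) (s₂-square k)) (drop a (b * U₂ k)))
    where distribute : ∀ s t a b → t * (a * s + b * t) ≡ a * (s * t) + b * (t * t)
          distribute = solve-∀
          drop : ∀ a u → a * 0ℤ + u ≡ u
          drop = solve-∀

  m₁≡0 : M x₁ y₁ ≡ 0ℤ
  m₁≡0 = positive-factor (sum-≥1 (λ y → U₁ (R x₁ y)) (λ y → U₁-nonneg (R x₁ y)) y₁ (cong U₁ R-x₁y₁)) (begin
    M x₁ y₁ * sum (λ y → U₁ (R x₁ y))        ≡⟨ sym (sum-*ˡ (M x₁ y₁) (λ y → U₁ (R x₁ y))) ⟩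
    sum (λ y → M x₁ y₁ * U₁ (R x₁ y))        ≡⟨ sum-cong (λ y → sym (trans (cong (E₁ x₁ y *_) (M-expansion x₁ y)) (along-E₁ (R x₁ y) (M x₁ y₁) (M x₃ y₃)))) ⟩
    sum (λ y → E₁ x₁ y * M x₁ y)             ≡⟨ form-skewʳ E₁ E₂-skew x₁ ⟩
    0ℤ                                       ∎)
    where open ≡-Reasoning

  m₃≡0 : M x₃ y₃ ≡ 0ℤ
  m₃≡0 = positive-factor (sum-≥1 (λ x → U₂ (R x y₃)) (λ x → U₂-nonneg (R x y₃)) x₃ (cong U₂ R-x₃y₃)) (begin
    M x₃ y₃ * sum (λ x → U₂ (R x y₃))        ≡⟨ sym (sum-*ˡ (M x₃ y₃) (λ x → U₂ (R x y₃))) ⟩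
    sum (λ x → M x₃ y₃ * U₂ (R x y₃))        ≡⟨ sum-cong (λ x → sym (trans (cong (E₂ x y₃ *_) (M-expansion x y₃)) (along-E₂ (R x y₃) (M x₁ y₁) (M x₃ y₃)))) ⟩
    sum (λ x → E₂ x y₃ * M x y₃)             ≡⟨ form-skewˡ E₂ E₁-skew y₃ ⟩
    0ℤ                                       ∎)
    where open ≡-Reasoning

  E₁E₂≡0 : ∀ x y → M x y ≡ 0ℤ
  E₁E₂≡0 x y = trans (M-expansion x y) (trans (cong₂ (λ a b → a * E₁ x y + b * E₂ x y) m₁≡0 m₃≡0) (vanish (E₁ x y) (E₂ x y)))
    where vanish : ∀ e f → 0ℤ * e + 0ℤ * f ≡ 0ℤ
          vanish = solve-∀

  -- S = E₁² satisfies E₁ S = S E₁ = -n E₁: indeed S = J - n I - E₂² while E₁ has zero column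
  -- sums and E₂² E₁ = E₂ (E₂ E₁) = 0.  Consequently S² = -n S.
  S : Mat n
  S = E₁ ⊛ E₁

  S-symmetric : ∀ x y → S y x ≡ S x y
  S-symmetric = skew-⊛-transpose E₁-skew E₁-skew

  E₂E₁≡0 : ∀ x y → (E₂ ⊛ E₁) x y ≡ 0ℤ
  E₂E₁≡0 x y = trans (sym (+-identityˡ _)) (trans (cong (_+ (E₂ ⊛ E₁) x y) (sym (E₁E₂≡0 x y))) (anticommute x y))

  S-times-E₁ : ∀ x y → (S ⊛ E₁) x y ≡ - (+ n * E₁ x y)
  S-times-E₁ x y = begin
    sum (λ z → S x z * E₁ z y)
      ≡⟨ sum-cong (λ z → trans (cong (_* E₁ z y) (isolate (S x z) (squares-sum x z))) (spread (+ n) (δ x z) ((E₂ ⊛ E₂) x z) (E₁ z y))) ⟩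
    sum (λ z → E₁ z y + (- + n) * (δ x z * E₁ z y) + - ((E₂ ⊛ E₂) x z * E₁ z y))
      ≡⟨ trans (sum-+ (λ z → E₁ z y + (- + n) * (δ x z * E₁ z y)) (λ z → - ((E₂ ⊛ E₂) x z * E₁ z y)))
               (cong₂ _+_ (sum-+ (λ z → E₁ z y) (λ z → (- + n) * (δ x z * E₁ z y))) (sum-neg (λ z → (E₂ ⊛ E₂) x z * E₁ z y))) ⟩
    sum (λ z → E₁ z y) + sum (λ z → (- + n) * (δ x z * E₁ z y)) + - ((E₂ ⊛ E₂) ⊛ E₁) x y
      ≡⟨ cong₂ (λ u v → u + v + - ((E₂ ⊛ E₂) ⊛ E₁) x y) (skew-cols-zero E₁-skew E₁-rows y)
               (trans (sum-*ˡ (- + n) (λ z → δ x z * E₁ z y)) (cong ((- + n) *_) (sum-δ x (λ z → E₁ z y)))) ⟩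
    0ℤ + (- + n) * E₁ x y + - ((E₂ ⊛ E₂) ⊛ E₁) x y
      ≡⟨ cong (λ t → 0ℤ + (- + n) * E₁ x y + - t) (trans (⊛-assoc E₂ E₂ E₁ x y) (trans (sum-cong (λ z → trans (cong (E₂ x z *_) (E₂E₁≡0 z y)) (*-zeroʳ (E₂ x z)))) (sum-zero {n}))) ⟩
    0ℤ + (- + n) * E₁ x y + - 0ℤ
      ≡⟨ tidy (+ n) (E₁ x y) ⟩
    - (+ n * E₁ x y) ∎
    where
    open ≡-Reasoning
    isolate : ∀ u {v w} → u + v ≡ w → u ≡ w - v
    isolate u {v} {w} u+v≡w = trans (solve-isolate u v) (cong (_- v) u+v≡w)
      where solve-isolate : ∀ u v → u ≡ (u + v) - v
            solve-isolate = solve-∀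
    spread : ∀ k d t e → ((1ℤ - k * d) - t) * e ≡ e + (- k) * (d * e) + - (t * e)
    spread = solve-∀
    tidy : ∀ k e → 0ℤ + (- k) * e + - 0ℤ ≡ - (k * e)
    tidy = solve-∀

  S-square-diagonal : ∀ x → (S ⊛ S) x x ≡ - (+ n * S x x)
  S-square-diagonal x = begin
    (S ⊛ (E₁ ⊛ E₁)) x x                        ≡⟨ sym (⊛-assoc S E₁ E₁ x x) ⟩
    sum (λ w → (S ⊛ E₁) x w * E₁ w x)           ≡⟨ sum-cong (λ w → trans (cong (_* E₁ w x) (S-times-E₁ x w)) (pull (+ n) (E₁ x w) (E₁ w x))) ⟩
    sum (λ w → (- + n) * (E₁ x w * E₁ w x))     ≡⟨ sum-*ˡ (- + n) (λ w → E₁ x w * E₁ w x) ⟩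
    (- + n) * S x x                            ≡⟨ neg-distribˡ-* (+ n) (S x x) ⟨
    - (+ n * S x x)                            ∎
    where
    open ≡-Reasoning
    pull : ∀ k a b → - (k * a) * b ≡ (- k) * (a * b)
    pull = solve-∀

  -- The parameters of S in the row of x₁: S = -N I + b (A_α + A_α') + c (A_P + A_P'),
  -- where N and N₂ are the valencies of {α, α'} and P ∪ P'.
  N N₂ b c : ℤ
  N = sum (λ z → U₁ (R x₁ z))
  N₂ = sum (λ z → U₂ (R x₁ z))
  b = S x₁ y₁
  c = S x₃ y₃

  N≥1 : 1ℤ ≤ N
  N≥1 = sum-≥1 (λ z → U₁ (R x₁ z)) (λ z → U₁-nonneg (R x₁ z)) y₁ (cong U₁ R-x₁y₁)

  N₂≥1 : 1ℤ ≤ N₂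
  N₂≥1 = subst (1ℤ ≤_) (R-row-sum-invariant U₂ x₃ x₁)
           (sum-≥1 (λ z → U₂ (R x₃ z)) (λ z → U₂-nonneg (R x₃ z)) y₃ (cong U₂ R-x₃y₃))

  S-diagonal : S x₁ x₁ ≡ - N
  S-diagonal = trans (sum-cong (λ z → trans (cong (E₁ x₁ z *_) (E₁-skew x₁ z))
                                           (trans (times-neg (E₁ x₁ z)) (cong -_ (s₁-square (R x₁ z))))))
                     (sum-neg (λ z → U₁ (R x₁ z)))
    where times-neg : ∀ a → a * - a ≡ - (a * a)
          times-neg = solve-∀

  S-expansion : ∀ z → S x₁ z ≡ - N * D (R x₁ z) + b * U₁ (R x₁ z) + c * U₂ (R x₁ z)
  S-expansion z = trans (expand-symmetric (product-class s₁ s₁) S-symmetric x₁ z)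
                        (cong (λ t → t * D (R x₁ z) + b * U₁ (R x₁ z) + c * U₂ (R x₁ z)) S-diagonal)

  row-combination : ∀ a b c → sum (λ z → a * D (R x₁ z) + b * U₁ (R x₁ z) + c * U₂ (R x₁ z)) ≡ a + b * N + c * N₂
  row-combination a b c = begin
    sum (λ z → a * D (R x₁ z) + b * U₁ (R x₁ z) + c * U₂ (R x₁ z))
      ≡⟨ trans (sum-+ (λ z → a * D (R x₁ z) + b * U₁ (R x₁ z)) (λ z → c * U₂ (R x₁ z)))
               (cong (_+ sum (λ z → c * U₂ (R x₁ z))) (sum-+ (λ z → a * D (R x₁ z)) (λ z → b * U₁ (R x₁ z)))) ⟩
    sum (λ z → a * D (R x₁ z)) + sum (λ z → b * U₁ (R x₁ z)) + sum (λ z → c * U₂ (R x₁ z))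
      ≡⟨ cong₂ (λ u v → u + v + sum (λ z → c * U₂ (R x₁ z))) (sum-*ˡ a (λ z → D (R x₁ z))) (sum-*ˡ b (λ z → U₁ (R x₁ z))) ⟩
    a * sum (λ z → D (R x₁ z)) + b * N + sum (λ z → c * U₂ (R x₁ z))
      ≡⟨ cong₂ (λ u v → a * u + b * N + v) diagonal-count (sum-*ˡ c (λ z → U₂ (R x₁ z))) ⟩
    a * 1ℤ + b * N + c * N₂
      ≡⟨ cong (λ t → t + b * N + c * N₂) (*-identityʳ a) ⟩
    a + b * N + c * N₂ ∎
    where
    open ≡-Reasoning
    diagonal-count : sum (λ z → D (R x₁ z)) ≡ 1ℤ
    diagonal-count = trans (sum-cong (λ z → trans (D-diagonal (R x₁ z)) (sym (R-δ-diagonal x₁ z)))) (sum-δ-one x₁)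

  -- The three equations: counting points, the row sum of S, and the diagonal of S² = -n S.
  order : + n ≡ 1ℤ + N + N₂
  order = begin
    + n                                                            ≡⟨ sym (trans (sum-const {n} 1ℤ) (*-identityʳ (+ n))) ⟩
    sum {n} (λ _ → 1ℤ)                                             ≡⟨ sum-cong (λ z → sym (trans (ones (R x₁ z)) (partition (R x₁ z)))) ⟩
    sum (λ z → 1ℤ * D (R x₁ z) + 1ℤ * U₁ (R x₁ z) + 1ℤ * U₂ (R x₁ z)) ≡⟨ row-combination 1ℤ 1ℤ 1ℤ ⟩
    1ℤ + 1ℤ * N + 1ℤ * N₂                                          ≡⟨ cong₂ (λ u v → 1ℤ + u + v) (*-identityˡ N) (*-identityˡ N₂) ⟩
    1ℤ + N + N₂                                                    ∎
    where
    open ≡-Reasoning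
    ones : ∀ k → 1ℤ * D k + 1ℤ * U₁ k + 1ℤ * U₂ k ≡ D k + U₁ k + U₂ k
    ones k = unit (D k) (U₁ k) (U₂ k)
      where unit : ∀ d u v → 1ℤ * d + 1ℤ * u + 1ℤ * v ≡ d + u + v
            unit = solve-∀

  linear : - N + b * N + c * N₂ ≡ 0ℤ
  linear = begin
    - N + b * N + c * N₂                                          ≡⟨ sym (row-combination (- N) b c) ⟩
    sum (λ z → - N * D (R x₁ z) + b * U₁ (R x₁ z) + c * U₂ (R x₁ z)) ≡⟨ sum-cong (λ z → sym (S-expansion z)) ⟩
    sum (S x₁)                                                    ≡⟨ rows-zero-⊛ E₁ {E₁} E₁-rows x₁ ⟩
    0ℤ                                                            ∎
    where open ≡-Reasoning

  quadratic : N * N + b * b * N + c * c * N₂ ≡ + n * N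
  quadratic = begin
    N * N + b * b * N + c * c * N₂
      ≡⟨ cong (λ t → t + b * b * N + c * c * N₂) (sym (neg-square N)) ⟩
    - N * - N + b * b * N + c * c * N₂
      ≡⟨ sym (row-combination (- N * - N) (b * b) (c * c)) ⟩
    sum (λ z → - N * - N * D (R x₁ z) + b * b * U₁ (R x₁ z) + c * c * U₂ (R x₁ z))
      ≡⟨ sum-cong (λ z → sym (trans (cong₂ _*_ (S-expansion z) (S-expansion z)) (square-combination (R x₁ z) (- N) b c))) ⟩
    sum (λ z → S x₁ z * S x₁ z)
      ≡⟨ sum-cong (λ z → cong (S x₁ z *_) (sym (S-symmetric x₁ z))) ⟩
    (S ⊛ S) x₁ x₁
      ≡⟨ S-square-diagonal x₁ ⟩
    - (+ n * S x₁ x₁)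
      ≡⟨ cong (λ t → - (+ n * t)) S-diagonal ⟩
    - (+ n * - N)
      ≡⟨ neg-neg-product (+ n) N ⟩
    + n * N ∎
    where
    open ≡-Reasoning
    neg-square : ∀ a → - a * - a ≡ a * a
    neg-square = solve-∀
    neg-neg-product : ∀ k a → - (k * - a) ≡ k * a
    neg-neg-product = solve-∀

  completed-square : (N + c) * (N + c) ≡ + n * (c * c)
  completed-square = feasibility {+ n} {N} {N₂} {b} {c} N₂≥1 order linear quadratic

  impossible : ⊥
  impossible = not-a-square (proj₁ T₊.order-mod-4) {N} {c} N≥1
                 (trans completed-square (cong (λ t → + t * (c * c)) (proj₂ T₊.order-mod-4)))

mainTheorem2 : (n d : ℕ) (r : RelAssign n d) → 2 ℕ.≤ n → 4 ℕ.≤ d →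
    IsScheme r → SkewSymmetric r → ¬ Amorphous r
mainTheorem2 (suc (suc m)) (suc (suc (suc (suc d)))) r _ _ sch skew amorphous =
  SkewAmorphous.impossible r sch skew amorphous
mainTheorem2 zero _ _ () _
mainTheorem2 (suc zero) _ _ (ℕ.s≤s ()) _
mainTheorem2 (suc (suc m)) zero _ _ ()
mainTheorem2 (suc (suc m)) (suc zero) _ _ (ℕ.s≤s ())
mainTheorem2 (suc (suc m)) (suc (suc zero)) _ _ (ℕ.s≤s (ℕ.s≤s ()))
mainTheorem2 (suc (suc m)) (suc (suc (suc zero))) _ _ (ℕ.s≤s (ℕ.s≤s (ℕ.s≤s ())))
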